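{- Let $n\ge3$ be odd, $U=V(n,2)$ with a nondegenerate symmetric bilinear form $\mathsf b$, let $\Sigma$ be a symplectic spread-set of $U$, and let $C:U\to\Sigma$ be its canonical labeling. Then $\Delta_\Sigma=\{B(a):=C(a)+E_{a,a}\mid a\in U\}$ is a DHO-set of skew-symmetric operators, i.e. $\{V(B(a))\mid a\in U\}$, with $V(L)=\{(x,xL)\mid x\in U\}$, is an orthogonal dual hyperoval of $U\oplus U$ (with quadratic form $Q((x,y))=\mathsf b(x,y)$) splitting over $0\oplus U$.
   Context: Operators act on the right; $xE_{a,b}=\mathsf b(x,a)b$. $T$ is self-adjoint if $\mathsf b(xT,y)=\mathsf b(x,yT)$ for all $x,y$, and skew-symmetric if moreover $\mathsf b(x,xT)=0$ for all $x$. A symplectic spread-set of $U$ is a set of $2^n$ self-adjoint operators containing $0$ with $L+L'$ invertible for all distinct members. For odd $n$ its canonical labeling is the unique bijection $C:U\to\Sigma$ with $C(a)+E_{a,a}$ skew-symmetric for all $a$. A dual hyperoval of rank $n$ over $\mathbb F_2$ in $W$ is a set of $2^n$ $n$-dimensional subspaces spanning $W$, any two meeting in a 1-dimensional subspace and any three meeting in $0$; it is orthogonal if all members are totally singular for $Q$, and splits over $Y$ if $W=X\oplus Y$ for every member $X$. -}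

module Defs where

open import Data.Bool using (Bool; true; false; _xor_; _∧_; if_then_else_)
open import Data.Nat using (ℕ; zero; suc; _+_; _^_; _≤_; _%_)
open import Data.Fin using (Fin; _≟_)
open import Data.Vec using (Vec; []; _∷_; zipWith; replicate; tabulate; take; drop)
open import Data.List using (List; length; map; _++_) renaming ([] to []ˡ; _∷_ to _∷ˡ_)
open import Data.List.Membership.Propositional using (_∈_)
open import Data.List.Relation.Unary.All using (All)
open import Data.List.Relation.Unary.AllPairs using (AllPairs)
open import Data.List.Relation.Unary.Unique.Propositional using (Unique)
open import Data.Product using (Σ; _×_; ∃)
open import Relation.Binary.PropositionalEquality using (_≡_; _≢_)
open import Relation.Nullary using (¬_)
open import Relation.Nullary.Decidable using (isYes)

-- F₂-vector spaces  V(m,2) = Vec Bool m  (true = 1, xor = +, ∧ = ·)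

Vect : ℕ → Set
Vect m = Vec Bool m

0v : ∀ {m} → Vect m
0v = replicate _ false

infixl 6 _⊕_
_⊕_ : ∀ {m} → Vect m → Vect m → Vect m
_⊕_ = zipWith _xor_

lsum : ∀ {m} → List (Vect m) → Vect m
lsum []ˡ = 0v
lsum (v ∷ˡ vs) = v ⊕ lsum vs

lincomb : ∀ {m d} → Vec (Vect m) d → Vect d → Vect m
lincomb [] [] = 0v
lincomb (v ∷ vs) (c ∷ cs) = (if c then v else 0v) ⊕ lincomb vs cs

allVecs : (n : ℕ) → List (Vect n)
allVecs zero = [] ∷ˡ []ˡ
allVecs (suc n) = map (true ∷_) (allVecs n) ++ map (false ∷_) (allVecs n)

e : ∀ {n} → Fin n → Vect n
e i = tabulate (λ j → isYes (i ≟ j))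

record NondegSymBilinear (n : ℕ) (b : Vect n → Vect n → Bool) : Set where
  field
    additiveˡ : ∀ x y z → b (x ⊕ y) z ≡ (b x z xor b y z)
    additiveʳ : ∀ x y z → b x (y ⊕ z) ≡ (b x y xor b x z)
    symmetric : ∀ x y → b x y ≡ b y x
    nondegenerate : ∀ x → (∀ y → b x y ≡ false) → x ≡ 0v

-- Operators on U = V(n,2), as n×n matrices acting on the right
-- (row vectors): x L = Σ_i x_i (row i of L).

Op : ℕ → Set
Op n = Vec (Vect n) n

_·_ : ∀ {n} → Vect n → Op n → Vect n
x · L = lincomb L x

0op : ∀ {n} → Op n
0op = replicate _ 0v

infixl 6 _+op_
_+op_ : ∀ {n} → Op n → Op n → Op n
_+op_ = zipWith _⊕_

-- E_{a,c} : x ↦ b(x,a) c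
E : ∀ {n} → (Vect n → Vect n → Bool) → Vect n → Vect n → Op n
E b a c = tabulate (λ i → if b (e i) a then c else 0v)

Invertible : ∀ {n} → Op n → Set
Invertible {n} L = Σ (Op n) λ S → (∀ x → (x · L) · S ≡ x) × (∀ x → (x · S) · L ≡ x)

SelfAdjoint : ∀ {n} → (Vect n → Vect n → Bool) → Op n → Set
SelfAdjoint b T = ∀ x y → b (x · T) y ≡ b x (y · T)

SkewSymmetric : ∀ {n} → (Vect n → Vect n → Bool) → Op n → Set
SkewSymmetric b T = SelfAdjoint b T × (∀ x → b x (x · T) ≡ false)

record SymplecticSpreadSet (n : ℕ) (b : Vect n → Vect n → Bool) (Σs : List (Op n)) : Set where
  field
    distinct   : Unique Σs
    size       : length Σs ≡ 2 ^ n
    hasZero    : 0op ∈ Σs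
    selfAdj    : All (SelfAdjoint b) Σs
    sumsInvert : AllPairs (λ L L' → Invertible (L +op L')) Σs

record CanonicalLabeling (n : ℕ) (b : Vect n → Vect n → Bool) (Σs : List (Op n))
                         (C : Vect n → Op n) : Set where
  field
    into    : ∀ a → C a ∈ Σs
    inj     : ∀ a a' → C a ≡ C a' → a ≡ a'
    onto    : ∀ L → L ∈ Σs → ∃ λ a → C a ≡ L
    skew    : ∀ a → SkewSymmetric b (C a +op E b a a)

Pred : ℕ → Set₁
Pred m = Vect m → Set

_∩_ : ∀ {m} → Pred m → Pred m → Pred m
(S ∩ T) w = S w × T w

SameSub : ∀ {m} → Pred m → Pred m → Set
SameSub S T = ∀ w → (S w → T w) × (T w → S w)

LinIndep : ∀ {m d} → Vec (Vect m) d → Set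
LinIndep {d = d} vs = ∀ c → lincomb vs c ≡ 0v → c ≡ replicate d false

HasDim : ∀ {m} → ℕ → Pred m → Set
HasDim {m} d S = Σ (Vec (Vect m) d) λ vs →
  LinIndep vs × (∀ w → (S w → ∃ λ c → lincomb vs c ≡ w) × ((∃ λ c → lincomb vs c ≡ w) → S w))

DirectSum : ∀ {m} → Pred m → Pred m → Set
DirectSum X Y = (∀ w → ∃ λ x → ∃ λ y → X x × Y y × (w ≡ x ⊕ y))
              × (∀ w → X w → Y w → w ≡ 0v)

-- The set {X a | a ∈ V(n,2)} is a dual hyperoval of rank n in W = V(m,2).
-- Its members are pairwise distinct (so it has 2^n members).
record DualHyperoval (n m : ℕ) (X : Vect n → Pred m) : Set where
  field
    distinctMembers : ∀ a a' → a ≢ a' → ¬ SameSub (X a) (X a')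
    rank     : ∀ a → HasDim n (X a)
    spanning : ∀ w → Σ (Vect n → Vect m) λ f → (∀ a → X a (f a)) × (w ≡ lsum (map f (allVecs n)))
    meet2    : ∀ a a' → a ≢ a' → HasDim 1 (X a ∩ X a')
    meet3    : ∀ a a' a'' → a ≢ a' → a ≢ a'' → a' ≢ a'' →
               ∀ w → X a w → X a' w → X a'' w → w ≡ 0v

Orthogonal : ∀ {n m} → (Vect m → Bool) → (Vect n → Pred m) → Set
Orthogonal Q X = ∀ a w → X a w → Q w ≡ false

SplitsOver : ∀ {n m} → Pred m → (Vect n → Pred m) → Set
SplitsOver Y X = ∀ a → DirectSum (X a) Y

-- W = U ⊕ U  realised as Vect (n + n), (x , y) ↦ x ++ y

VL : ∀ n → Op n → Pred (n + n)
VL n L w = ∃ λ (x : Vect n) → w ≡ x Data.Vec.++ (x · L)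

zeroPlusU : ∀ n → Pred (n + n)
zeroPlusU n w = ∃ λ (y : Vect n) → w ≡ 0v {n} Data.Vec.++ y

Qb : ∀ {n} → (Vect n → Vect n → Bool) → Vect (n + n) → Bool
Qb {n} b w = b (take n w) (drop n w)

module Submission where

-- Write B a = C a + E_{a,a}.  Skew-symmetry of B a says b(x, x·C a) = b(x, a), so for a ≠ a′ the
-- invertible self-adjoint operator M = C a + C a′ has "diagonal vector" a + a′, and a trace
-- computation gives b((a + a′)M⁻¹, a + a′) ≡ n ≡ 1 (mod 2).  Hence exactly one of aM⁻¹, a′M⁻¹ pairs
-- nontrivially with its own vector, and that vector p spans the kernel of B a + B a′, i.e. the first
-- coordinates of V(B a) ∩ V(B a′); moreover b(p, a) + b(p, a′) = 1.  A nonzero vector in the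
-- kernels for three pairs would violate this parity on one of them, and the images of B a + B a′
-- (the hyperplanes p⊥) for two different kernels yield the spanning property.  Orthogonality and
-- the splitting over 0 ⊕ U are immediate for graphs of skew-symmetric operators.

open import Defs
open import Algebra.Bundles using (CommutativeRing)
open import Data.Bool using (Bool; true; false; _xor_; _∧_; if_then_else_)
open import Data.Bool.Properties
  using (xor-assoc; xor-comm; xor-identityˡ; xor-identityʳ; xor-same;
         ∧-zeroʳ; ∧-identityʳ; ∧-comm; ∧-idem; ∧-assoc; xor-∧-commutativeRing)
import Data.Bool.Properties as Bool
open import Data.Empty using (⊥; ⊥-elim)
open import Data.Fin using (Fin; zero; suc; _≟_)
import Data.Fin.Properties as Fin
open import Data.List using (List; length) renaming ([] to []ˡ; _∷_ to _∷ˡ_; map to mapˡ)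
open import Data.List.Properties using (length-map)
open import Data.List.Membership.Propositional using (_∈_)
open import Data.List.Membership.Propositional.Properties using (∈-map⁺; ∈-map⁻; ∈-++⁺ˡ; ∈-++⁺ʳ)
open import Data.List.Relation.Unary.Any using (here; there; any?)
open import Data.List.Relation.Unary.All as All using (All; _∷_)
open import Data.List.Relation.Unary.AllPairs using (AllPairs; _∷_)
open import Data.List.Relation.Unary.Unique.Propositional using (Unique)
import Data.List.Relation.Unary.Unique.Propositional.Properties as Unique
open import Data.Nat using (ℕ; zero; suc; _+_; _≤_; _%_; s≤s; z≤n)
open import Data.Nat.Properties using (1+n≰n)
open import Data.Product using (Σ; ∃; _×_; _,_; proj₁; proj₂)
open import Data.Sum using (_⊎_; inj₁; inj₂)
open import Data.Vec using (Vec; []; _∷_; _++_; zipWith; replicate; tabulate; map; lookup; take; drop)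
open import Data.Vec.Properties
  using (zipWith-assoc; zipWith-comm; zipWith-identityˡ; zipWith-identityʳ; zipWith-++;
         tabulate-cong; tabulate-∘; tabulate∘lookup; lookup∘tabulate; lookup-replicate; lookup-map;
         ∷-injectiveʳ; ++-injectiveˡ; ++-injectiveʳ; take++drop≡id; ≡-dec)
open import Relation.Nullary using (¬_; yes; no)
open import Relation.Nullary.Decidable using (isYes; isYes≗does)
open import Relation.Binary.PropositionalEquality
open ≡-Reasoning

open import Algebra.Properties.Semiring.Sum (CommutativeRing.semiring xor-∧-commutativeRing)
  using (sum; sum-cong-≗; ∑-distrib-+; *-distribˡ-sum; sum-replicate-zero)

module _ {m : ℕ} where

  ⊕-assoc : (x y z : Vect m) → (x ⊕ y) ⊕ z ≡ x ⊕ (y ⊕ z)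
  ⊕-assoc = zipWith-assoc xor-assoc

  ⊕-comm : (x y : Vect m) → x ⊕ y ≡ y ⊕ x
  ⊕-comm = zipWith-comm xor-comm

  ⊕-identityˡ : (x : Vect m) → 0v ⊕ x ≡ x
  ⊕-identityˡ = zipWith-identityˡ xor-identityˡ

  ⊕-identityʳ : (x : Vect m) → x ⊕ 0v ≡ x
  ⊕-identityʳ = zipWith-identityʳ xor-identityʳ

⊕-self : ∀ {m} (x : Vect m) → x ⊕ x ≡ 0v
⊕-self []      = refl
⊕-self (a ∷ x) = cong₂ _∷_ (xor-same a) (⊕-self x)

module _ {m : ℕ} where

  ⊕-interchange : (x y z w : Vect m) → (x ⊕ y) ⊕ (z ⊕ w) ≡ (x ⊕ z) ⊕ (y ⊕ w)
  ⊕-interchange x y z w = begin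
    (x ⊕ y) ⊕ (z ⊕ w)  ≡⟨ ⊕-assoc x y (z ⊕ w) ⟩
    x ⊕ (y ⊕ (z ⊕ w))  ≡⟨ cong (x ⊕_) (sym (⊕-assoc y z w)) ⟩
    x ⊕ ((y ⊕ z) ⊕ w)  ≡⟨ cong (λ u → x ⊕ (u ⊕ w)) (⊕-comm y z) ⟩
    x ⊕ ((z ⊕ y) ⊕ w)  ≡⟨ cong (x ⊕_) (⊕-assoc z y w) ⟩
    x ⊕ (z ⊕ (y ⊕ w))  ≡⟨ sym (⊕-assoc x z (y ⊕ w)) ⟩
    (x ⊕ z) ⊕ (y ⊕ w)  ∎

  ⊕-cancelˡ : (x y : Vect m) → x ⊕ (x ⊕ y) ≡ y
  ⊕-cancelˡ x y = begin
    x ⊕ (x ⊕ y)  ≡⟨ sym (⊕-assoc x x y) ⟩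
    (x ⊕ x) ⊕ y  ≡⟨ cong (_⊕ y) (⊕-self x) ⟩
    0v ⊕ y       ≡⟨ ⊕-identityˡ y ⟩
    y            ∎

  ⊕≡0v⇒≡ : (x y : Vect m) → x ⊕ y ≡ 0v → x ≡ y
  ⊕≡0v⇒≡ x y x⊕y≡0 = begin
    x            ≡⟨ sym (⊕-identityʳ x) ⟩
    x ⊕ 0v       ≡⟨ cong (x ⊕_) (sym x⊕y≡0) ⟩
    x ⊕ (x ⊕ y)  ≡⟨ ⊕-cancelˡ x y ⟩
    y            ∎

⊕-transpose : ∀ {m} (x y z w : Vect m) → x ⊕ y ≡ z ⊕ w → x ⊕ z ≡ y ⊕ w
⊕-transpose x y z w eq = ⊕≡0v⇒≡ (x ⊕ z) (y ⊕ w) (begin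
  (x ⊕ z) ⊕ (y ⊕ w)  ≡⟨ ⊕-interchange x z y w ⟩
  (x ⊕ y) ⊕ (z ⊕ w)  ≡⟨ cong (_⊕ (z ⊕ w)) eq ⟩
  (z ⊕ w) ⊕ (z ⊕ w)  ≡⟨ ⊕-self _ ⟩
  0v                 ∎)

infixr 7 _•_
_•_ : ∀ {m} → Bool → Vect m → Vect m
s • v = if s then v else 0v

module _ {m : ℕ} where

  •-distribʳ : ∀ s t (v : Vect m) → (s xor t) • v ≡ s • v ⊕ t • v
  •-distribʳ false t     v = sym (⊕-identityˡ (t • v))
  •-distribʳ true  false v = sym (⊕-identityʳ v)
  •-distribʳ true  true  v = sym (⊕-self v)

  •-distribˡ : ∀ s (v w : Vect m) → s • (v ⊕ w) ≡ s • v ⊕ s • w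
  •-distribˡ false v w = sym (⊕-identityˡ 0v)
  •-distribˡ true  v w = refl

  •-assoc : ∀ s t (v : Vect m) → s • t • v ≡ (s ∧ t) • v
  •-assoc false t v = refl
  •-assoc true  t v = refl

Additive : ∀ {m k} → (Vect m → Vect k) → Set
Additive f = ∀ x y → f (x ⊕ y) ≡ f x ⊕ f y

module _ {m k : ℕ} {f : Vect m → Vect k} (additive : Additive f) where

  additive⇒0v : f 0v ≡ 0v
  additive⇒0v = ⊕≡0v⇒≡ (f 0v) 0v (begin
    f 0v ⊕ 0v         ≡⟨ ⊕-identityʳ (f 0v) ⟩
    f 0v              ≡⟨ cong f (sym (⊕-self 0v)) ⟩
    f (0v ⊕ 0v)       ≡⟨ additive 0v 0v ⟩
    f 0v ⊕ f 0v       ≡⟨ ⊕-self (f 0v) ⟩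
    0v                ∎)

  additive⇒• : ∀ s v → f (s • v) ≡ s • f v
  additive⇒• false v = additive⇒0v
  additive⇒• true  v = refl

  lincomb-map : ∀ {d} (vs : Vec (Vect m) d) c → lincomb (map f vs) c ≡ f (lincomb vs c)
  lincomb-map []       []      = sym additive⇒0v
  lincomb-map (v ∷ vs) (s ∷ c) = begin
    s • f v ⊕ lincomb (map f vs) c  ≡⟨ cong₂ _⊕_ (sym (additive⇒• s v)) (lincomb-map vs c) ⟩
    f (s • v) ⊕ f (lincomb vs c)    ≡⟨ sym (additive _ _) ⟩
    f (s • v ⊕ lincomb vs c)        ∎

module _ {m : ℕ} where

  lincomb-⊕ : ∀ {d} (vs : Vec (Vect m) d) → Additive (lincomb vs)
  lincomb-⊕ []       []      []        = sym (⊕-identityˡ 0v)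
  lincomb-⊕ (v ∷ vs) (s ∷ c) (t ∷ c′) = begin
    (s xor t) • v ⊕ lincomb vs (c ⊕ c′)
      ≡⟨ cong₂ _⊕_ (•-distribʳ s t v) (lincomb-⊕ vs c c′) ⟩
    (s • v ⊕ t • v) ⊕ (lincomb vs c ⊕ lincomb vs c′)
      ≡⟨ ⊕-interchange _ _ _ _ ⟩
    (s • v ⊕ lincomb vs c) ⊕ (t • v ⊕ lincomb vs c′)
      ∎

  lincomb-zipWith : ∀ {d} (vs ws : Vec (Vect m) d) c →
                    lincomb (zipWith _⊕_ vs ws) c ≡ lincomb vs c ⊕ lincomb ws c
  lincomb-zipWith []       []       []      = sym (⊕-identityˡ 0v)
  lincomb-zipWith (v ∷ vs) (w ∷ ws) (s ∷ c) =
    trans (cong₂ _⊕_ (•-distribˡ s v w) (lincomb-zipWith vs ws c)) (⊕-interchange _ _ _ _)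

tabulate-false : ∀ m → tabulate {n = m} (λ _ → false) ≡ 0v
tabulate-false m = trans (tabulate-cong (λ i → sym (lookup-replicate i false))) (tabulate∘lookup 0v)

e-zero : ∀ {n} → e {suc n} zero ≡ true ∷ 0v
e-zero {n} = cong (true ∷_) (tabulate-false n)

e-suc : ∀ {n} (i : Fin n) → e (suc i) ≡ false ∷ e i
e-suc i = cong (false ∷_) (tabulate-cong (λ j → trans (isYes≗does (suc i ≟ suc j)) (sym (isYes≗does (i ≟ j)))))

lincomb-false∷ : ∀ {m d} (vs : Vec (Vect m) d) c → lincomb (map (false ∷_) vs) c ≡ false ∷ lincomb vs c
lincomb-false∷ vs c = lincomb-map (λ _ _ → refl) vs c

lincomb-e : ∀ {n} (x : Vect n) → lincomb (tabulate e) x ≡ x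
lincomb-e []            = refl
lincomb-e {suc n} (s ∷ x) = begin
  s • e zero ⊕ lincomb (tabulate (λ i → e (suc i))) x
    ≡⟨ cong₂ (λ u w → s • u ⊕ lincomb w x) e-zero (trans (tabulate-cong e-suc) (tabulate-∘ (false ∷_) e)) ⟩
  s • (true ∷ 0v) ⊕ lincomb (map (false ∷_) (tabulate e)) x
    ≡⟨ cong (s • (true ∷ 0v) ⊕_) (trans (lincomb-false∷ (tabulate e) x) (cong (false ∷_) (lincomb-e x))) ⟩
  s • (true ∷ 0v) ⊕ (false ∷ x)
    ≡⟨ head-step s ⟩
  s ∷ x ∎
  where
  head-step : ∀ s → s • (true ∷ 0v) ⊕ (false ∷ x) ≡ s ∷ x
  head-step false = cong (false ∷_) (⊕-identityˡ x)
  head-step true  = cong (true ∷_) (⊕-identityˡ x)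

lookup-e-diag : ∀ {n} (i : Fin n) → lookup (e i) i ≡ true
lookup-e-diag {suc n} zero    = cong (λ u → lookup u zero) (e-zero {n})
lookup-e-diag {suc n} (suc i) = trans (cong (λ u → lookup u (suc i)) (e-suc i)) (lookup-e-diag i)

module LinearForm {m : ℕ} (φ : Vect m → Bool) (additive : ∀ x y → φ (x ⊕ y) ≡ φ x xor φ y) where

  φ-0v : φ 0v ≡ false
  φ-0v = idempotent⇒false (φ 0v) (trans (cong φ (sym (⊕-self 0v))) (additive 0v 0v))
    where
    idempotent⇒false : ∀ a → a ≡ a xor a → a ≡ false
    idempotent⇒false false _ = refl
    idempotent⇒false true  ()

  φ-• : ∀ s v → φ (s • v) ≡ s ∧ φ v
  φ-• false v = φ-0v
  φ-• true  v = refl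

  φ-lincomb : ∀ {d} (vs : Vec (Vect m) d) c → φ (lincomb vs c) ≡ sum (λ i → lookup c i ∧ φ (lookup vs i))
  φ-lincomb []       []      = φ-0v
  φ-lincomb (v ∷ vs) (s ∷ c) = trans (additive _ _) (cong₂ _xor_ (φ-• s v) (φ-lincomb vs c))

  φ-expand : ∀ x → φ x ≡ sum (λ i → lookup x i ∧ φ (e i))
  φ-expand x = begin
    φ x                                                 ≡⟨ cong φ (sym (lincomb-e x)) ⟩
    φ (lincomb (tabulate e) x)                          ≡⟨ φ-lincomb (tabulate e) x ⟩
    sum (λ i → lookup x i ∧ φ (lookup (tabulate e) i))  ≡⟨ sum-cong-≗ (λ i → cong (λ u → lookup x i ∧ φ u)
                                                                              (lookup∘tabulate e i)) ⟩
    sum (λ i → lookup x i ∧ φ (e i))                    ∎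

lincomb-tabulate-• : ∀ {k m} (s : Fin k → Bool) (c : Vect m) (x : Vect k) →
                     lincomb (tabulate (λ i → s i • c)) x ≡ sum (λ i → lookup x i ∧ s i) • c
lincomb-tabulate-• s c []      = refl
lincomb-tabulate-• s c (t ∷ x) = begin
  t • s zero • c ⊕ lincomb (tabulate (λ i → s (suc i) • c)) x
    ≡⟨ cong₂ _⊕_ (•-assoc t (s zero) c) (lincomb-tabulate-• (λ i → s (suc i)) c x) ⟩
  (t ∧ s zero) • c ⊕ sum (λ i → lookup x i ∧ s (suc i)) • c
    ≡⟨ sym (•-distribʳ (t ∧ s zero) _ c) ⟩
  ((t ∧ s zero) xor sum (λ i → lookup x i ∧ s (suc i))) • c ∎

·-additive : ∀ {n} (L : Op n) → Additive (_· L)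
·-additive L = lincomb-⊕ L

0v-· : ∀ {n} (L : Op n) → 0v · L ≡ 0v
0v-· L = additive⇒0v (·-additive L)

·-+op : ∀ {n} (x : Vect n) (L L′ : Op n) → x · (L +op L′) ≡ x · L ⊕ x · L′
·-+op x L L′ = lincomb-zipWith L L′ x

+op-comm : ∀ {n} (L L′ : Op n) → L +op L′ ≡ L′ +op L
+op-comm = zipWith-comm ⊕-comm

sum-e : ∀ {n} (f : Fin n → Bool) k → sum (λ l → f l ∧ lookup (e k) l) ≡ f k
sum-e {suc n} f zero = begin
  f zero ∧ lookup (e {suc n} zero) zero xor sum (λ l → f (suc l) ∧ lookup (e zero) (suc l))
    ≡⟨ cong (λ u → f zero ∧ lookup u zero xor sum (λ l → f (suc l) ∧ lookup u (suc l))) e-zero ⟩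
  f zero ∧ true xor sum (λ l → f (suc l) ∧ lookup 0v l)
    ≡⟨ cong₂ _xor_ (∧-identityʳ (f zero))
                   (sum-cong-≗ (λ l → trans (cong (f (suc l) ∧_) (lookup-replicate l false)) (∧-zeroʳ (f (suc l))))) ⟩
  f zero xor sum {n} (λ _ → false)
    ≡⟨ cong (f zero xor_) (sum-replicate-zero n) ⟩
  f zero xor false
    ≡⟨ xor-identityʳ (f zero) ⟩
  f zero ∎
sum-e {suc n} f (suc k) = begin
  f zero ∧ lookup (e (suc k)) zero xor sum (λ l → f (suc l) ∧ lookup (e (suc k)) (suc l))
    ≡⟨ cong (λ u → f zero ∧ lookup u zero xor sum (λ l → f (suc l) ∧ lookup u (suc l))) (e-suc k) ⟩
  f zero ∧ false xor sum (λ l → f (suc l) ∧ lookup (e k) l)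
    ≡⟨ cong₂ _xor_ (∧-zeroʳ (f zero)) (sum-e (λ l → f (suc l)) k) ⟩
  f (suc k) ∎

-- In characteristic 2 the off-diagonal terms of a symmetric double sum cancel in pairs.
sum-symmetric : ∀ {n} (f : Fin n → Fin n → Bool) → (∀ i j → f i j ≡ f j i) →
                sum (λ i → sum (λ j → f i j)) ≡ sum (λ i → f i i)
sum-symmetric {zero}  f symm = refl
sum-symmetric {suc n} f symm = begin
  (f zero zero xor R) xor sum (λ i → f (suc i) zero xor sum (λ j → f (suc i) (suc j)))
    ≡⟨ cong ((f zero zero xor R) xor_) (∑-distrib-+ (λ i → f (suc i) zero) (λ i → sum (λ j → f (suc i) (suc j)))) ⟩
  (f zero zero xor R) xor (sum (λ i → f (suc i) zero) xor sum (λ i → sum (λ j → f (suc i) (suc j))))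
    ≡⟨ cong₂ (λ r d → (f zero zero xor R) xor (r xor d))
         (sum-cong-≗ (λ i → symm (suc i) zero))
         (sum-symmetric (λ i j → f (suc i) (suc j)) (λ i j → symm (suc i) (suc j))) ⟩
  (f zero zero xor R) xor (R xor D)
    ≡⟨ cancel (f zero zero) R D ⟩
  f zero zero xor D ∎
  where
  R = sum (λ j → f zero (suc j))
  D = sum (λ i → f (suc i) (suc i))
  cancel : ∀ a r d → (a xor r) xor (r xor d) ≡ a xor d
  cancel a r d = begin
    (a xor r) xor (r xor d)  ≡⟨ xor-assoc a r (r xor d) ⟩
    a xor (r xor (r xor d))  ≡⟨ cong (a xor_) (sym (xor-assoc r r d)) ⟩
    a xor ((r xor r) xor d)  ≡⟨ cong (λ t → a xor (t xor d)) (xor-same r) ⟩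
    a xor d                  ∎

sum-true-odd : ∀ n → n % 2 ≡ 1 → sum {n} (λ _ → true) ≡ true
sum-true-odd 1             _   = refl
sum-true-odd (suc (suc n)) odd = trans (lemma (sum {n} (λ _ → true))) (sum-true-odd n odd)
  where
  lemma : ∀ a → true xor (true xor a) ≡ a
  lemma false = refl
  lemma true  = refl

module _ {A : Set} where

  remove : ∀ {x : A} (ys : List A) → x ∈ ys → List A
  remove (y ∷ˡ ys) (here _)  = ys
  remove (y ∷ˡ ys) (there p) = y ∷ˡ remove ys p

  length-remove : ∀ {x : A} (ys : List A) (p : x ∈ ys) → length ys ≡ suc (length (remove ys p))
  length-remove (y ∷ˡ ys) (here _)  = refl
  length-remove (y ∷ˡ ys) (there p) = cong suc (length-remove ys p)

  ∈-remove : ∀ {x z : A} (ys : List A) (p : x ∈ ys) → z ∈ ys → z ≢ x → z ∈ remove ys p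
  ∈-remove (y ∷ˡ ys) (here refl) (here refl) z≢x = ⊥-elim (z≢x refl)
  ∈-remove (y ∷ˡ ys) (here refl) (there q)   z≢x = q
  ∈-remove (y ∷ˡ ys) (there p)   (here eq)   z≢x = here eq
  ∈-remove (y ∷ˡ ys) (there p)   (there q)   z≢x = there (∈-remove ys p q z≢x)

  unique-⊆⇒length-≤ : ∀ (xs ys : List A) → Unique xs → (∀ {z} → z ∈ xs → z ∈ ys) → length xs ≤ length ys
  unique-⊆⇒length-≤ []ˡ        ys _          _  = z≤n
  unique-⊆⇒length-≤ (x ∷ˡ xs) ys (x∉xs ∷ u) xs⊆ys =
    subst (suc (length xs) ≤_) (sym (length-remove ys x∈ys))
      (s≤s (unique-⊆⇒length-≤ xs (remove ys x∈ys) u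
        (λ z∈xs → ∈-remove ys x∈ys (xs⊆ys (there z∈xs)) (λ z≡x → All.lookup x∉xs z∈xs (sym z≡x)))))
    where x∈ys = xs⊆ys (here refl)

∈-allVecs : ∀ {n} (v : Vect n) → v ∈ allVecs n
∈-allVecs []             = here refl
∈-allVecs {suc n} (true ∷ v)  = ∈-++⁺ˡ (∈-map⁺ (true ∷_) (∈-allVecs v))
∈-allVecs {suc n} (false ∷ v) = ∈-++⁺ʳ (mapˡ (true ∷_) (allVecs n)) (∈-map⁺ (false ∷_) (∈-allVecs v))

allVecs-unique : ∀ n → Unique (allVecs n)
allVecs-unique zero    = All.[] ∷ Unique.[]
allVecs-unique (suc n) =
  Unique.++⁺ (Unique.map⁺ ∷-injectiveʳ (allVecs-unique n)) (Unique.map⁺ ∷-injectiveʳ (allVecs-unique n)) disjoint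
  where
  disjoint : ∀ {v} → ¬ (v ∈ mapˡ (true ∷_) (allVecs n) × v ∈ mapˡ (false ∷_) (allVecs n))
  disjoint (p , q) with ∈-map⁻ (true ∷_) p | ∈-map⁻ (false ∷_) q
  ... | _ , _ , refl | _ , _ , ()

injective⇒surjective : ∀ {n} (f : Vect n → Vect n) → (∀ x y → f x ≡ f y → x ≡ y) → ∀ y → ∃ λ x → f x ≡ y
injective⇒surjective {n} f f-inj y with any? (λ z → ≡-dec Bool._≟_ y z) (mapˡ f (allVecs n))
... | yes y∈image = let x , _ , y≡fx = ∈-map⁻ f y∈image in x , sym y≡fx
... | no  y∉image = ⊥-elim (1+n≰n too-long)
  where
  unique : Unique (y ∷ˡ mapˡ f (allVecs n))
  unique = All.tabulate (λ q y≡z → y∉image (subst (_∈ mapˡ f (allVecs n)) (sym y≡z) q))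
         ∷ Unique.map⁺ (λ {a} {b} → f-inj a b) (allVecs-unique n)
  too-long : suc (length (allVecs n)) ≤ length (allVecs n)
  too-long = subst (λ k → suc k ≤ length (allVecs n)) (length-map f (allVecs n))
    (unique-⊆⇒length-≤ (y ∷ˡ mapˡ f (allVecs n)) (allVecs n) unique (λ {z} _ → ∈-allVecs z))

allPairs-∈ : ∀ {A : Set} {R : A → A → Set} {xs : List A} → AllPairs R xs →
             ∀ {x y} → x ∈ xs → y ∈ xs → x ≢ y → R x y ⊎ R y x
allPairs-∈ (_  ∷ _)  (here refl) (here refl) x≢y = ⊥-elim (x≢y refl)
allPairs-∈ (Rx ∷ _)  (here refl) (there y∈) _   = inj₁ (All.lookup Rx y∈)
allPairs-∈ (Rx ∷ _)  (there x∈)  (here refl) _  = inj₂ (All.lookup Rx x∈)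
allPairs-∈ (_  ∷ Rs) (there x∈)  (there y∈) x≢y = allPairs-∈ Rs x∈ y∈ x≢y

module Form {n : ℕ} {b : Vect n → Vect n → Bool} (nd : NondegSymBilinear n b) where

  open NondegSymBilinear nd

  module Left  (y : Vect n) = LinearForm (λ x → b x y) (λ x x′ → additiveˡ x x′ y)
  module Right (x : Vect n) = LinearForm (b x) (additiveʳ x)

  b-•ˡ : ∀ s x y → b (s • x) y ≡ s ∧ b x y
  b-•ˡ s x y = Left.φ-• y s x

  b-•ʳ : ∀ x s y → b x (s • y) ≡ s ∧ b x y
  b-•ʳ x = Right.φ-• x

  ·-E : ∀ x a c → x · E b a c ≡ b x a • c
  ·-E x a c = trans (lincomb-tabulate-• (λ i → b (e i) a) c x) (cong (_• c) (sym (Left.φ-expand a x)))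

  b-separates : ∀ y y′ → (∀ i → b (e i) y ≡ b (e i) y′) → y ≡ y′
  b-separates y y′ agree = ⊕≡0v⇒≡ y y′ (nondegenerate (y ⊕ y′) λ x → begin
    b (y ⊕ y′) x                                   ≡⟨ symmetric _ x ⟩
    b x (y ⊕ y′)                                   ≡⟨ Left.φ-expand (y ⊕ y′) x ⟩
    sum (λ i → lookup x i ∧ b (e i) (y ⊕ y′))      ≡⟨ sum-cong-≗ (λ i → cong (lookup x i ∧_) (vanish i)) ⟩
    sum (λ i → lookup x i ∧ false)                 ≡⟨ sum-cong-≗ (λ i → ∧-zeroʳ (lookup x i)) ⟩
    sum {n} (λ _ → false)                          ≡⟨ sum-replicate-zero n ⟩
    false                                          ∎)
    where
    vanish : ∀ i → b (e i) (y ⊕ y′) ≡ false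
    vanish i = trans (additiveʳ (e i) y y′) (trans (cong (_xor b (e i) y′) (agree i)) (xor-same (b (e i) y′)))

  nonzero⇒witness : ∀ x → x ≢ 0v → ∃ λ y → b y x ≡ true
  nonzero⇒witness x x≢0 with Fin.any? (λ i → b (e i) x Bool.≟ true)
  ... | yes (i , bix) = e i , bix
  ... | no none       = ⊥-elim (x≢0 (b-separates x 0v (λ i → trans (orthogonal i) (sym (Right.φ-0v (e i))))))
    where
    orthogonal : ∀ i → b (e i) x ≡ false
    orthogonal i with b (e i) x in bix
    ... | false = refl
    ... | true  = ⊥-elim (none (i , bix))

  separating-vector : ∀ k₁ k₂ → k₁ ≢ 0v → k₁ ≢ k₂ → ∃ λ t → b t k₁ ≡ true × b t k₂ ≡ false
  separating-vector k₁ k₂ k₁≢0 k₁≢k₂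
    with nonzero⇒witness (k₁ ⊕ k₂) (λ eq → k₁≢k₂ (⊕≡0v⇒≡ k₁ k₂ eq)) | nonzero⇒witness k₁ k₁≢0
  ... | y , y·k₁₂ | y′ , y′·k₁ = by-cases (b y k₁) (b y k₂) refl refl (trans (sym (additiveʳ y k₁ k₂)) y·k₁₂)
    where
    by-cases : ∀ s t → b y k₁ ≡ s → b y k₂ ≡ t → s xor t ≡ true → ∃ λ t → b t k₁ ≡ true × b t k₂ ≡ false
    by-cases true  false y·k₁ y·k₂ _ = y , y·k₁ , y·k₂
    by-cases false true  y·k₁ y·k₂ _ with b y′ k₂ in y′·k₂
    ... | false = y′ , y′·k₁ , y′·k₂
    ... | true  = y′ ⊕ y , trans (additiveˡ y′ y k₁) (cong₂ _xor_ y′·k₁ y·k₁)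
                         , trans (additiveˡ y′ y k₂) (cong₂ _xor_ y′·k₂ y·k₂)
    by-cases false false _ _ ()
    by-cases true  true  _ _ ()

  gram : Vect n → Vect n
  gram y = tabulate (λ i → b (e i) y)

  gram-injective : ∀ y y′ → gram y ≡ gram y′ → y ≡ y′
  gram-injective y y′ eq = b-separates y y′ (λ i → begin
    b (e i) y            ≡⟨ sym (lookup∘tabulate _ i) ⟩
    lookup (gram y) i    ≡⟨ cong (λ u → lookup u i) eq ⟩
    lookup (gram y′) i   ≡⟨ lookup∘tabulate _ i ⟩
    b (e i) y′           ∎)

  dual : Fin n → Vect n
  dual j = proj₁ (injective⇒surjective gram gram-injective (e j))

  b-e-dual : ∀ i j → b (e i) (dual j) ≡ lookup (e j) i
  b-e-dual i j = begin
    b (e i) (dual j)          ≡⟨ sym (lookup∘tabulate _ i) ⟩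
    lookup (gram (dual j)) i  ≡⟨ cong (λ u → lookup u i) (proj₂ (injective⇒surjective gram gram-injective (e j))) ⟩
    lookup (e j) i            ∎

  b-dual : ∀ k w → b (dual k) w ≡ lookup w k
  b-dual k w = begin
    b (dual k) w                                   ≡⟨ symmetric (dual k) w ⟩
    b w (dual k)                                   ≡⟨ Left.φ-expand (dual k) w ⟩
    sum (λ l → lookup w l ∧ b (e l) (dual k))      ≡⟨ sum-cong-≗ (λ l → cong (lookup w l ∧_) (b-e-dual l k)) ⟩
    sum (λ l → lookup w l ∧ lookup (e k) l)        ≡⟨ sum-e (lookup w) k ⟩
    lookup w k                                     ∎

  sum-b-dual : ∀ z w → sum (λ k → b z (e k) ∧ b (dual k) w) ≡ b z w
  sum-b-dual z w = begin
    sum (λ k → b z (e k) ∧ b (dual k) w)   ≡⟨ sum-cong-≗ (λ k → trans (cong (b z (e k) ∧_) (b-dual k w))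
                                                                   (trans (∧-comm (b z (e k)) (lookup w k)) (cong (lookup w k ∧_) (symmetric z (e k))))) ⟩
    sum (λ k → lookup w k ∧ b (e k) z)     ≡⟨ sym (Left.φ-expand z w) ⟩
    b w z                                  ≡⟨ symmetric w z ⟩
    b z w                                  ∎

  -- For self-adjoint M the quadratic map x ↦ b(x, xM) is linear; d represents it.
  Diagonal : Op n → Vect n → Set
  Diagonal M d = ∀ x → b x (x · M) ≡ b x d

  +op-selfAdjoint : ∀ {L L′ : Op n} → SelfAdjoint b L → SelfAdjoint b L′ → SelfAdjoint b (L +op L′)
  +op-selfAdjoint {L} {L′} L-sa L′-sa x y = begin
    b (x · (L +op L′)) y            ≡⟨ cong (λ u → b u y) (·-+op x L L′) ⟩
    b (x · L ⊕ x · L′) y            ≡⟨ additiveˡ _ _ y ⟩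
    b (x · L) y xor b (x · L′) y    ≡⟨ cong₂ _xor_ (L-sa x y) (L′-sa x y) ⟩
    b x (y · L) xor b x (y · L′)    ≡⟨ sym (additiveʳ x _ _) ⟩
    b x (y · L ⊕ y · L′)            ≡⟨ cong (b x) (sym (·-+op y L L′)) ⟩
    b x (y · (L +op L′))            ∎

  +op-diagonal : ∀ {L L′ : Op n} {d d′} → Diagonal L d → Diagonal L′ d′ → Diagonal (L +op L′) (d ⊕ d′)
  +op-diagonal {L} {L′} {d} {d′} L-d L′-d′ x = begin
    b x (x · (L +op L′))            ≡⟨ cong (b x) (·-+op x L L′) ⟩
    b x (x · L ⊕ x · L′)            ≡⟨ additiveʳ x _ _ ⟩
    b x (x · L) xor b x (x · L′)    ≡⟨ cong₂ _xor_ (L-d x) (L′-d′ x) ⟩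
    b x d xor b x d′                ≡⟨ sym (additiveʳ x d d′) ⟩
    b x (d ⊕ d′)                    ∎

  selfAdjoint-inverse : ∀ {M S : Op n} → SelfAdjoint b M → (∀ x → (x · S) · M ≡ x) → SelfAdjoint b S
  selfAdjoint-inverse {M} {S} M-sa SM≡id x y = begin
    b (x · S) y                ≡⟨ cong (b (x · S)) (sym (SM≡id y)) ⟩
    b (x · S) ((y · S) · M)    ≡⟨ sym (M-sa (x · S) (y · S)) ⟩
    b ((x · S) · M) (y · S)    ≡⟨ cong (λ u → b u (y · S)) (SM≡id x) ⟩
    b x (y · S)                ∎

  -- In the bases e and dual, G and H are the matrices of M and of S = M⁻¹.  The coordinates of d
  -- in the dual basis are the diagonal of G, so b(dS, d) = Σᵢⱼ Gᵢᵢ Gⱼⱼ Hᵢⱼ; by symmetry this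
  -- collapses to Σᵢ Gᵢᵢ Hᵢᵢ and then to tr(GH) = n.
  module DiagonalTrace {M S : Op n} (M-sa : SelfAdjoint b M)
                       (MS≡id : ∀ x → (x · M) · S ≡ x) (SM≡id : ∀ x → (x · S) · M ≡ x)
                       {d : Vect n} (diagonal : Diagonal M d) where

    S-sa : SelfAdjoint b S
    S-sa = selfAdjoint-inverse {M} {S} M-sa SM≡id

    G H : Fin n → Fin n → Bool
    G i k = b (e i · M) (e k)
    H k j = b (dual k · S) (dual j)

    G-symmetric : ∀ i k → G i k ≡ G k i
    G-symmetric i k = trans (M-sa (e i) (e k)) (symmetric (e i) (e k · M))

    H-symmetric : ∀ k j → H k j ≡ H j k
    H-symmetric k j = trans (S-sa (dual k) (dual j)) (symmetric (dual k) (dual j · S))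

    GH≡id : ∀ i j → sum (λ k → G i k ∧ H k j) ≡ lookup (e j) i
    GH≡id i j = begin
      sum (λ k → G i k ∧ H k j)                      ≡⟨ sum-cong-≗ (λ k → cong (G i k ∧_) (S-sa (dual k) (dual j))) ⟩
      sum (λ k → G i k ∧ b (dual k) (dual j · S))    ≡⟨ sum-b-dual (e i · M) (dual j · S) ⟩
      b (e i · M) (dual j · S)                       ≡⟨ sym (S-sa (e i · M) (dual j)) ⟩
      b ((e i · M) · S) (dual j)                     ≡⟨ cong (λ u → b u (dual j)) (MS≡id (e i)) ⟩
      b (e i) (dual j)                               ≡⟨ b-e-dual i j ⟩
      lookup (e j) i                                 ∎

    trace-GH : sum (λ i → G i i ∧ H i i) ≡ sum {n} (λ _ → true)
    trace-GH = begin
      sum (λ i → G i i ∧ H i i)                  ≡⟨ sym (sum-symmetric (λ i k → G i k ∧ H k i)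
                                                       (λ i k → cong₂ _∧_ (G-symmetric i k) (H-symmetric k i))) ⟩
      sum (λ i → sum (λ k → G i k ∧ H k i))      ≡⟨ sum-cong-≗ (λ i → trans (GH≡id i i) (lookup-e-diag i)) ⟩
      sum {n} (λ _ → true)                       ∎

    g : Vect n
    g = tabulate (λ i → G i i)

    duals : Vec (Vect n) n
    duals = tabulate dual

    d-coordinates : d ≡ lincomb duals g
    d-coordinates = b-separates d (lincomb duals g) λ j → sym (begin
      b (e j) (lincomb duals g)                          ≡⟨ Right.φ-lincomb (e j) duals g ⟩
      sum (λ i → lookup g i ∧ b (e j) (lookup duals i))  ≡⟨ sum-cong-≗ (λ i → cong₂ (λ p q → p ∧ b (e j) q)
                                                                          (lookup∘tabulate _ i) (lookup∘tabulate dual i)) ⟩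
      sum (λ i → G i i ∧ b (e j) (dual i))               ≡⟨ sum-cong-≗ (λ i → cong (G i i ∧_)
                                                                          (trans (symmetric _ _) (b-dual i (e j)))) ⟩
      sum (λ i → G i i ∧ lookup (e j) i)                 ≡⟨ sum-e (λ i → G i i) j ⟩
      G j j                                              ≡⟨ M-sa (e j) (e j) ⟩
      b (e j) (e j · M)                                  ≡⟨ diagonal (e j) ⟩
      b (e j) d                                          ∎)

    b-lincomb-duals : ∀ x → b x (lincomb duals g) ≡ sum (λ j → G j j ∧ b x (dual j))
    b-lincomb-duals x = trans (Right.φ-lincomb x duals g)
      (sum-cong-≗ (λ j → cong₂ (λ p q → p ∧ b x q) (lookup∘tabulate _ j) (lookup∘tabulate dual j)))

    diagonal-trace : b (d · S) d ≡ sum {n} (λ _ → true)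
    diagonal-trace = begin
      b (d · S) d
        ≡⟨ cong (λ u → b (u · S) u) d-coordinates ⟩
      b (lincomb duals g · S) (lincomb duals g)
        ≡⟨ cong (λ u → b u (lincomb duals g)) (sym (lincomb-map (·-additive S) duals g)) ⟩
      b (lincomb (map (_· S) duals) g) (lincomb duals g)
        ≡⟨ Left.φ-lincomb (lincomb duals g) (map (_· S) duals) g ⟩
      sum (λ i → lookup g i ∧ b (lookup (map (_· S) duals) i) (lincomb duals g))
        ≡⟨ sum-cong-≗ (λ i → cong₂ (λ p q → p ∧ b q (lincomb duals g))
                                (lookup∘tabulate _ i) (trans (lookup-map i (_· S) duals) (cong (_· S) (lookup∘tabulate dual i)))) ⟩
      sum (λ i → G i i ∧ b (dual i · S) (lincomb duals g))
        ≡⟨ sum-cong-≗ (λ i → trans (cong (G i i ∧_) (b-lincomb-duals (dual i · S)))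
                                   (*-distribˡ-sum {n} (G i i) (λ j → G j j ∧ b (dual i · S) (dual j)))) ⟩
      sum (λ i → sum (λ j → G i i ∧ (G j j ∧ H i j)))
        ≡⟨ sum-symmetric (λ i j → G i i ∧ (G j j ∧ H i j)) (λ i j → swap (G i i) (G j j) (H-symmetric i j)) ⟩
      sum (λ i → G i i ∧ (G i i ∧ H i i))
        ≡⟨ sum-cong-≗ (λ i → trans (sym (∧-assoc (G i i) (G i i) (H i i))) (cong (_∧ H i i) (∧-idem (G i i)))) ⟩
      sum (λ i → G i i ∧ H i i)
        ≡⟨ trace-GH ⟩
      sum {n} (λ _ → true)
        ∎
      where
      swap : ∀ p q {h h′} → h ≡ h′ → p ∧ (q ∧ h) ≡ q ∧ (p ∧ h′)
      swap false false refl = refl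
      swap false true  refl = refl
      swap true  false refl = refl
      swap true  true  refl = refl

0v-++ : ∀ m k → 0v {m + k} ≡ 0v {m} ++ 0v {k}
0v-++ zero    k = refl
0v-++ (suc m) k = cong (false ∷_) (0v-++ m k)

module _ {n : ℕ} where

  graph : Op n → Vect n → Vect (n + n)
  graph L x = x ++ x · L

  graph-0v : ∀ L → graph L 0v ≡ 0v
  graph-0v L = trans (cong (0v ++_) (0v-· L)) (sym (0v-++ n n))

  graph-additive : ∀ L → Additive (graph L)
  graph-additive L x y = trans (cong ((x ⊕ y) ++_) (·-additive L x y)) (sym (zipWith-++ _xor_ x (x · L) y (y · L)))

  graph-injective : ∀ {L L′} x y → graph L x ≡ graph L′ y → x ≡ y × x · L ≡ x · L′
  graph-injective {L} {L′} x y eq = x≡y , trans (++-injectiveʳ x y eq) (cong (_· L′) (sym x≡y))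
    where x≡y = ++-injectiveˡ x y eq

  graph≡0v : ∀ L x → graph L x ≡ 0v → x ≡ 0v
  graph≡0v L x eq = ++-injectiveˡ x 0v (trans eq (0v-++ n n))

  VL-0v : ∀ L → VL n L 0v
  VL-0v L = 0v , sym (graph-0v L)

  VL-⊕ : ∀ L {w w′} → VL n L w → VL n L w′ → VL n L (w ⊕ w′)
  VL-⊕ L (x , refl) (y , refl) = x ⊕ y , sym (graph-additive L x y)

  VL-rank : ∀ L → HasDim n (VL n L)
  VL-rank L = basis , independent , λ w → (λ { (x , refl) → x , spans x }) , (λ { (c , eq) → c , trans (sym eq) (spans c) })
    where
    basis : Vec (Vect (n + n)) n
    basis = map (graph L) (tabulate e)
    spans : ∀ c → lincomb basis c ≡ graph L c
    spans c = trans (lincomb-map (graph-additive L) (tabulate e) c) (cong (graph L) (lincomb-e c))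
    independent : LinIndep basis
    independent c eq = graph≡0v L c (trans (sym (spans c)) eq)

  VL-splits : ∀ L → DirectSum (VL n L) (zeroPlusU n)
  VL-splits L = decompose , meet
    where
    decompose : ∀ w → ∃ λ x → ∃ λ y → VL n L x × zeroPlusU n y × w ≡ x ⊕ y
    decompose w = graph L u , 0v ++ (u · L ⊕ v) , (u , refl) , (_ , refl) , sym (begin
      graph L u ⊕ (0v ++ (u · L ⊕ v))   ≡⟨ zipWith-++ _xor_ u (u · L) 0v (u · L ⊕ v) ⟩
      (u ⊕ 0v) ++ (u · L ⊕ (u · L ⊕ v))  ≡⟨ cong₂ _++_ (⊕-identityʳ u) (⊕-cancelˡ (u · L) v) ⟩
      u ++ v                            ≡⟨ take++drop≡id n w ⟩
      w                                 ∎)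
      where
      u = take n w
      v = drop n w
    meet : ∀ w → VL n L w → zeroPlusU n w → w ≡ 0v
    meet w (x , refl) (y , eq) = trans (cong (graph L) (++-injectiveˡ x 0v eq)) (graph-0v L)

  VL-orthogonal : ∀ {b : Vect n → Vect n → Bool} {L} → (∀ x → b x (x · L) ≡ false) → ∀ w → VL n L w → Qb b w ≡ false
  VL-orthogonal {b} {L} skew w (x , refl) = trans (cong₂ b (++-injectiveˡ _ x split) (++-injectiveʳ _ x split)) (skew x)
    where split = take++drop≡id n (graph L x)

  VL-meet : ∀ {L L′} k → k ≢ 0v → k · L ≡ k · L′ → (∀ x → x · L ≡ x · L′ → x ≡ 0v ⊎ x ≡ k) →
            HasDim 1 (VL n L ∩ VL n L′)
  VL-meet {L} {L′} k k≢0 k-common only-k = graph L k ∷ [] , independent , λ w → to w , from w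
    where
    independent : LinIndep (graph L k ∷ [])
    independent (false ∷ []) _  = refl
    independent (true ∷ [])  eq = ⊥-elim (k≢0 (graph≡0v L k (trans (sym (⊕-identityʳ (graph L k))) eq)))
    to : ∀ w → (VL n L ∩ VL n L′) w → ∃ λ c → lincomb (graph L k ∷ []) c ≡ w
    to w ((x , refl) , (y , w≡)) with graph-injective {L} {L′} x y w≡
    ... | _ , common with only-k x common
    ...   | inj₁ refl = false ∷ [] , trans (⊕-identityˡ 0v) (sym (graph-0v L))
    ...   | inj₂ refl = true ∷ [] , ⊕-identityʳ (graph L k)
    from : ∀ w → (∃ λ c → lincomb (graph L k ∷ []) c ≡ w) → (VL n L ∩ VL n L′) w
    from w (false ∷ [] , refl) = subst (VL n L ∩ VL n L′) (sym (⊕-identityˡ 0v)) (VL-0v L , VL-0v L′)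
    from w (true ∷ []  , refl) = subst (VL n L ∩ VL n L′) (sym (⊕-identityʳ (graph L k)))
                                   ((k , refl) , (k , cong (k ++_) k-common))

lsum-⊕ : ∀ {n m} (as : List (Vect n)) (f g : Vect n → Vect m) →
         lsum (mapˡ (λ a → f a ⊕ g a) as) ≡ lsum (mapˡ f as) ⊕ lsum (mapˡ g as)
lsum-⊕ []ˡ       f g = sym (⊕-identityˡ 0v)
lsum-⊕ (a ∷ˡ as) f g = trans (cong (f a ⊕ g a ⊕_) (lsum-⊕ as f g)) (⊕-interchange _ _ _ _)

module Span {n m : ℕ} (X : Vect n → Pred m) (X-0v : ∀ a → X a 0v)
            (X-⊕ : ∀ a {w w′} → X a w → X a w′ → X a (w ⊕ w′)) where

  InSpan : Pred m
  InSpan w = Σ (Vect n → Vect m) λ f → (∀ a → X a (f a)) × (w ≡ lsum (mapˡ f (allVecs n)))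

  InSpan-⊕ : ∀ {w w′} → InSpan w → InSpan w′ → InSpan (w ⊕ w′)
  InSpan-⊕ (f , fX , w≡) (g , gX , w′≡) =
    (λ a → f a ⊕ g a) , (λ a → X-⊕ a (fX a) (gX a)) , trans (cong₂ _⊕_ w≡ w′≡) (sym (lsum-⊕ (allVecs n) f g))

  private
    only : Vect n → Vect m → Vect n → Vect m
    only a w a′ = if isYes (≡-dec Bool._≟_ a a′) then w else 0v

    lsum-only-∉ : ∀ a w as → All (a ≢_) as → lsum (mapˡ (only a w) as) ≡ 0v
    lsum-only-∉ a w []ˡ       _ = refl
    lsum-only-∉ a w (a′ ∷ˡ as) (a≢a′ All.∷ a∉as) with ≡-dec Bool._≟_ a a′
    ... | yes a≡a′ = ⊥-elim (a≢a′ a≡a′)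
    ... | no  _    = trans (⊕-identityˡ _) (lsum-only-∉ a w as a∉as)

    lsum-only-∈ : ∀ a w as → Unique as → a ∈ as → lsum (mapˡ (only a w) as) ≡ w
    lsum-only-∈ a w (a′ ∷ˡ as) (a′∉as ∷ u) a∈ with ≡-dec Bool._≟_ a a′ | a∈
    ... | yes refl | _         = trans (cong (w ⊕_) (lsum-only-∉ a w as a′∉as)) (⊕-identityʳ w)
    ... | no  a≢a′ | here a≡a′ = ⊥-elim (a≢a′ a≡a′)
    ... | no  _    | there a∈as = trans (⊕-identityˡ _) (lsum-only-∈ a w as u a∈as)

  member⇒InSpan : ∀ a {w} → X a w → InSpan w
  member⇒InSpan a {w} Xaw = only a w , member , sym (lsum-only-∈ a w (allVecs n) (allVecs-unique n) (∈-allVecs a))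
    where
    member : ∀ a′ → X a′ (only a w a′)
    member a′ with ≡-dec Bool._≟_ a a′
    ... | yes refl = Xaw
    ... | no  _    = X-0v a′

module DHO {n : ℕ} (n-odd : n % 2 ≡ 1)
           {b : Vect n → Vect n → Bool} (nd : NondegSymBilinear n b)
           {Σs : List (Op n)} (ss : SymplecticSpreadSet n b Σs)
           {C : Vect n → Op n} (cl : CanonicalLabeling n b Σs C) where

  open NondegSymBilinear nd
  open Form nd
  open SymplecticSpreadSet ss using (selfAdj; sumsInvert)
  open CanonicalLabeling cl using (into; inj; skew)

  B : Vect n → Op n
  B a = C a +op E b a a

  ·-B : ∀ x a → x · B a ≡ x · C a ⊕ b x a • a
  ·-B x a = trans (·-+op x (C a) (E b a a)) (cong (x · C a ⊕_) (·-E x a a))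

  C-diagonal : ∀ a → Diagonal (C a) a
  C-diagonal a x = xor≡false⇒≡ (begin
    b x (x · C a) xor b x a              ≡⟨ cong (b x (x · C a) xor_) (sym (trans (b-•ʳ x (b x a) a) (∧-idem (b x a)))) ⟩
    b x (x · C a) xor b x (b x a • a)    ≡⟨ sym (additiveʳ x _ _) ⟩
    b x (x · C a ⊕ b x a • a)            ≡⟨ cong (b x) (sym (·-B x a)) ⟩
    b x (x · B a)                        ≡⟨ proj₂ (skew a) x ⟩
    false                                ∎)
    where
    xor≡false⇒≡ : ∀ {p q} → p xor q ≡ false → p ≡ q
    xor≡false⇒≡ {false} {false} _ = refl
    xor≡false⇒≡ {true}  {true}  _ = refl

  ΔC : Vect n → Vect n → Op n
  ΔC a a′ = C a +op C a′

  ΔC-selfAdjoint : ∀ a a′ → SelfAdjoint b (ΔC a a′)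
  ΔC-selfAdjoint a a′ = +op-selfAdjoint {C a} {C a′} (All.lookup selfAdj (into a)) (All.lookup selfAdj (into a′))

  ΔC-diagonal : ∀ a a′ → Diagonal (ΔC a a′) (a ⊕ a′)
  ΔC-diagonal a a′ = +op-diagonal {C a} {C a′} (C-diagonal a) (C-diagonal a′)

  ΔC-invertible : ∀ {a a′} → a ≢ a′ → Invertible (ΔC a a′)
  ΔC-invertible {a} {a′} a≢a′ with allPairs-∈ sumsInvert (into a) (into a′) (λ eq → a≢a′ (inj a a′ eq))
  ... | inj₁ invertible = invertible
  ... | inj₂ invertible = subst Invertible (+op-comm (C a′) (C a)) invertible

  Coincide : Vect n → Vect n → Vect n → Set
  Coincide a a′ x = x · B a ≡ x · B a′

  coincide⇒ΔC : ∀ {a a′ x} → Coincide a a′ x → x · ΔC a a′ ≡ b x a • a ⊕ b x a′ • a′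
  coincide⇒ΔC {a} {a′} {x} eq =
    trans (·-+op x (C a) (C a′)) (⊕-transpose _ _ _ _ (trans (sym (·-B x a)) (trans eq (·-B x a′))))

  ΔC⇒coincide : ∀ {a a′ x} → x · ΔC a a′ ≡ b x a • a ⊕ b x a′ • a′ → Coincide a a′ x
  ΔC⇒coincide {a} {a′} {x} eq =
    trans (·-B x a) (trans (⊕-transpose _ _ _ _ (trans (sym (·-+op x (C a) (C a′))) eq)) (sym (·-B x a′)))

  record Kernel (a a′ : Vect n) : Set where
    field
      vector    : Vect n
      nonzero   : vector ≢ 0v
      coincides : Coincide a a′ vector
      unique    : ∀ x → Coincide a a′ x → x ≡ 0v ⊎ x ≡ vector
      odd       : ∀ x → Coincide a a′ x → x ≢ 0v → b x a xor b x a′ ≡ true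
      image     : ∀ z → b z vector ≡ false → ∃ λ u → u · B a ⊕ u · B a′ ≡ z

  Kernel-sym : ∀ {a a′} → Kernel a a′ → Kernel a′ a
  Kernel-sym {a} {a′} κ = record
    { vector    = vector
    ; nonzero   = nonzero
    ; coincides = sym coincides
    ; unique    = λ x eq → unique x (sym eq)
    ; odd       = λ x eq x≢0 → trans (xor-comm (b x a′) (b x a)) (odd x (sym eq) x≢0)
    ; image     = λ z z⊥ → let u , eq = image z z⊥ in u , trans (⊕-comm _ _) eq
    }
    where open Kernel κ

  -- The kernel of B a + B a′ is spanned by p or by q.
  module Pair (a a′ : Vect n) (S : Op n)
              (ΔS≡id : ∀ x → (x · ΔC a a′) · S ≡ x) (SΔ≡id : ∀ x → (x · S) · ΔC a a′ ≡ x) where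

    open DiagonalTrace {ΔC a a′} {S} (ΔC-selfAdjoint a a′) ΔS≡id SΔ≡id (ΔC-diagonal a a′) using (S-sa; diagonal-trace)

    p q : Vect n
    p = a · S
    q = a′ · S

    private
      cancel : ∀ {s t} → s ≡ s xor t → t ≡ false
      cancel {false} eq      = sym eq
      cancel {true} {false} _ = refl
      cancel {true} {true} ()

    b-p-a′ : b p a′ ≡ false
    b-p-a′ = cancel (begin
      b p a                  ≡⟨ cong (b p) (sym (SΔ≡id a)) ⟩
      b p (p · ΔC a a′)      ≡⟨ ΔC-diagonal a a′ p ⟩
      b p (a ⊕ a′)           ≡⟨ additiveʳ p a a′ ⟩
      b p a xor b p a′       ∎)

    b-q-a : b q a ≡ false
    b-q-a = cancel (begin
      b q a′                 ≡⟨ cong (b q) (sym (SΔ≡id a′)) ⟩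
      b q (q · ΔC a a′)      ≡⟨ ΔC-diagonal a a′ q ⟩
      b q (a ⊕ a′)           ≡⟨ additiveʳ q a a′ ⟩
      b q a xor b q a′       ≡⟨ xor-comm (b q a) (b q a′) ⟩
      b q a′ xor b q a       ∎)

    b-p-a+b-q-a′ : b p a xor b q a′ ≡ true
    b-p-a+b-q-a′ = begin
      b p a xor b q a′                             ≡⟨ cong (_xor b q a′) (sym (xor-identityʳ (b p a))) ⟩
      (b p a xor false) xor (false xor b q a′)     ≡⟨ cong₂ (λ s t → (b p a xor s) xor (t xor b q a′))
                                                            (sym b-p-a′) (sym b-q-a) ⟩
      (b p a xor b p a′) xor (b q a xor b q a′)    ≡⟨ cong₂ _xor_ (sym (additiveʳ p a a′)) (sym (additiveʳ q a a′)) ⟩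
      b p (a ⊕ a′) xor b q (a ⊕ a′)                ≡⟨ sym (additiveˡ p q (a ⊕ a′)) ⟩
      b (p ⊕ q) (a ⊕ a′)                           ≡⟨ cong (λ u → b u (a ⊕ a′)) (sym (·-additive S a a′)) ⟩
      b ((a ⊕ a′) · S) (a ⊕ a′)                    ≡⟨ diagonal-trace ⟩
      sum {n} (λ _ → true)                         ≡⟨ sum-true-odd n n-odd ⟩
      true                                         ∎

    coincide⇒p,q : ∀ x → Coincide a a′ x → x ≡ b x a • p ⊕ b x a′ • q
    coincide⇒p,q x eq = begin
      x                                          ≡⟨ sym (ΔS≡id x) ⟩
      (x · ΔC a a′) · S                          ≡⟨ cong (_· S) (coincide⇒ΔC eq) ⟩
      (b x a • a ⊕ b x a′ • a′) · S              ≡⟨ ·-additive S _ _ ⟩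
      (b x a • a) · S ⊕ (b x a′ • a′) · S        ≡⟨ cong₂ _⊕_ (additive⇒• (·-additive S) (b x a) a)
                                                             (additive⇒• (·-additive S) (b x a′) a′) ⟩
      b x a • p ⊕ b x a′ • q                     ∎

    module Oriented (b-p-a : b p a ≡ true) where

      b-q-a′ : b q a′ ≡ false
      b-q-a′ = true-xor (trans (cong (_xor b q a′) (sym b-p-a)) b-p-a+b-q-a′)
        where
        true-xor : ∀ {t} → true xor t ≡ true → t ≡ false
        true-xor {false} _ = refl

      coincide⇒a′ : ∀ x → Coincide a a′ x → b x a′ ≡ false
      coincide⇒a′ x eq = begin
        b x a′                                        ≡⟨ cong (λ u → b u a′) (coincide⇒p,q x eq) ⟩
        b (b x a • p ⊕ b x a′ • q) a′                 ≡⟨ additiveˡ _ _ a′ ⟩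
        b (b x a • p) a′ xor b (b x a′ • q) a′        ≡⟨ cong₂ _xor_ (b-•ˡ (b x a) p a′) (b-•ˡ (b x a′) q a′) ⟩
        (b x a ∧ b p a′) xor (b x a′ ∧ b q a′)        ≡⟨ cong₂ (λ s t → (b x a ∧ s) xor (b x a′ ∧ t)) b-p-a′ b-q-a′ ⟩
        (b x a ∧ false) xor (b x a′ ∧ false)          ≡⟨ cong₂ _xor_ (∧-zeroʳ (b x a)) (∧-zeroʳ (b x a′)) ⟩
        false                                         ∎

      coincide⇒p : ∀ x → Coincide a a′ x → x ≡ b x a • p
      coincide⇒p x eq = begin
        x                          ≡⟨ coincide⇒p,q x eq ⟩
        b x a • p ⊕ b x a′ • q     ≡⟨ cong (λ t → b x a • p ⊕ t • q) (coincide⇒a′ x eq) ⟩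
        b x a • p ⊕ 0v             ≡⟨ ⊕-identityʳ _ ⟩
        b x a • p                  ∎

      p≢0 : p ≢ 0v
      p≢0 p≡0 with trans (sym b-p-a) (trans (cong (λ u → b u a) p≡0) (Left.φ-0v a))
      ... | ()

      p-coincides : Coincide a a′ p
      p-coincides = ΔC⇒coincide (begin
        p · ΔC a a′              ≡⟨ SΔ≡id a ⟩
        a                        ≡⟨ sym (⊕-identityʳ a) ⟩
        true • a ⊕ false • a′    ≡⟨ cong₂ (λ s t → s • a ⊕ t • a′) (sym b-p-a) (sym b-p-a′) ⟩
        b p a • a ⊕ b p a′ • a′  ∎)

      unique : ∀ x → Coincide a a′ x → x ≡ 0v ⊎ x ≡ p
      unique x eq = by-value (b x a) (coincide⇒p x eq)
        where
        by-value : ∀ s → x ≡ s • p → x ≡ 0v ⊎ x ≡ p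
        by-value false x≡0 = inj₁ x≡0
        by-value true  x≡p = inj₂ x≡p

      odd : ∀ x → Coincide a a′ x → x ≢ 0v → b x a xor b x a′ ≡ true
      odd x eq x≢0 = by-value (b x a) refl (coincide⇒p x eq)
        where
        by-value : ∀ s → b x a ≡ s → x ≡ s • p → b x a xor b x a′ ≡ true
        by-value false _   x≡0 = ⊥-elim (x≢0 x≡0)
        by-value true  x·a _   = cong₂ _xor_ x·a (coincide⇒a′ x eq)

      -- u := zS + b(zS, a′) q satisfies uΔC = z + b(zS, a′) a′ with b(u, a) = 0 and b(u, a′) = b(zS, a′).
      image : ∀ z → b z p ≡ false → ∃ λ u → u · B a ⊕ u · B a′ ≡ z
      image z z⊥p = u , (begin
        u · B a ⊕ u · B a′                                 ≡⟨ cong₂ _⊕_ (·-B u a) (·-B u a′) ⟩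
        (u · C a ⊕ b u a • a) ⊕ (u · C a′ ⊕ b u a′ • a′)   ≡⟨ ⊕-interchange _ _ _ _ ⟩
        (u · C a ⊕ u · C a′) ⊕ (b u a • a ⊕ b u a′ • a′)   ≡⟨ cong₂ _⊕_ (sym (·-+op u (C a) (C a′)))
                                                                     (cong₂ (λ s t → s • a ⊕ t • a′) u⊥a u·a′) ⟩
        u · ΔC a a′ ⊕ (false • a ⊕ γ • a′)                 ≡⟨ cong₂ _⊕_ uΔ (⊕-identityˡ _) ⟩
        (z ⊕ γ • a′) ⊕ γ • a′                              ≡⟨ ⊕-assoc _ _ _ ⟩
        z ⊕ (γ • a′ ⊕ γ • a′)                              ≡⟨ cong (z ⊕_) (⊕-self _) ⟩
        z ⊕ 0v                                             ≡⟨ ⊕-identityʳ z ⟩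
        z                                                  ∎)
        where
        γ = b (z · S) a′
        u = z · S ⊕ γ • q
        uΔ : u · ΔC a a′ ≡ z ⊕ γ • a′
        uΔ = trans (·-additive (ΔC a a′) _ _)
                   (cong₂ _⊕_ (SΔ≡id z) (trans (additive⇒• (·-additive (ΔC a a′)) γ q) (cong (γ •_) (SΔ≡id a′))))
        zS⊥a : b (z · S) a ≡ false
        zS⊥a = trans (symmetric _ _) (trans (sym (S-sa a z)) (trans (symmetric _ _) z⊥p))
        u⊥a : b u a ≡ false
        u⊥a = trans (additiveˡ _ _ a) (cong₂ _xor_ zS⊥a (trans (b-•ˡ γ q a) (trans (cong (γ ∧_) b-q-a) (∧-zeroʳ γ))))
        u·a′ : b u a′ ≡ γ
        u·a′ = trans (additiveˡ _ _ a′)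
                     (trans (cong (γ xor_) (trans (b-•ˡ γ q a′) (trans (cong (γ ∧_) b-q-a′) (∧-zeroʳ γ))))
                            (xor-identityʳ γ))

      kernel : Kernel a a′
      kernel = record { vector = p ; nonzero = p≢0 ; coincides = p-coincides
                      ; unique = unique ; odd = odd ; image = image }

  -- Since b(aS, a) + b(a′S, a′) = 1, one of (a, a′) and (a′, a) is oriented as Pair.Oriented needs.
  kernel : ∀ {a a′} → a ≢ a′ → Kernel a a′
  kernel {a} {a′} a≢a′ with ΔC-invertible a≢a′
  ... | S , ΔS≡id , SΔ≡id with b (a · S) a in b-p-a
  ...   | true  = Pair.Oriented.kernel a a′ S ΔS≡id SΔ≡id b-p-a
  ...   | false = Kernel-sym (Pair.Oriented.kernel a′ a S ΔS≡id′ SΔ≡id′ b-q-a′)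
    where
    ΔS≡id′ : ∀ x → (x · ΔC a′ a) · S ≡ x
    ΔS≡id′ x = subst (λ L → (x · L) · S ≡ x) (+op-comm (C a) (C a′)) (ΔS≡id x)
    SΔ≡id′ : ∀ x → (x · S) · ΔC a′ a ≡ x
    SΔ≡id′ x = subst (λ L → (x · S) · L ≡ x) (+op-comm (C a) (C a′)) (SΔ≡id x)
    b-q-a′ : b (a′ · S) a′ ≡ true
    b-q-a′ = trans (cong (_xor b (a′ · S) a′) (sym b-p-a)) (Pair.b-p-a+b-q-a′ a a′ S ΔS≡id SΔ≡id)

  no-common-kernel : ∀ {a a′ a″} → a ≢ a′ → a ≢ a″ → a′ ≢ a″ →
                     ∀ x → Coincide a a′ x → Coincide a a″ x → x ≢ 0v → ⊥
  no-common-kernel {a} {a′} {a″} a≢a′ a≢a″ a′≢a″ x eq′ eq″ x≢0 =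
    three-odd (b x a) (b x a′) (b x a″) (Kernel.odd (kernel a≢a′) x eq′ x≢0)
              (Kernel.odd (kernel a≢a″) x eq″ x≢0)
              (Kernel.odd (kernel a′≢a″) x (trans (sym eq′) eq″) x≢0)
    where
    three-odd : ∀ s t r → s xor t ≡ true → s xor r ≡ true → t xor r ≡ true → ⊥
    three-odd false false r     ()
    three-odd false true  false _ ()
    three-odd false true  true  _ _ ()
    three-odd true  false false _ _ ()
    three-odd true  false true  _ ()
    three-odd true  true  r     ()

  X : Vect n → Pred (n + n)
  X a = VL n (B a)

  open Span X (λ a → VL-0v (B a)) (λ a → VL-⊕ (B a))

  meet2 : ∀ a a′ → a ≢ a′ → HasDim 1 (X a ∩ X a′)
  meet2 a a′ a≢a′ = VL-meet {L = B a} {B a′} vector nonzero coincides unique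
    where open Kernel (kernel a≢a′)

  meet3 : ∀ a a′ a″ → a ≢ a′ → a ≢ a″ → a′ ≢ a″ → ∀ w → X a w → X a′ w → X a″ w → w ≡ 0v
  meet3 a a′ a″ a≢a′ a≢a″ a′≢a″ w (x , w≡) (y , w≡′) (z , w≡″) with ≡-dec Bool._≟_ x 0v
  ... | yes refl = trans w≡ (graph-0v (B a))
  ... | no  x≢0  = ⊥-elim (no-common-kernel a≢a′ a≢a″ a′≢a″ x
                     (proj₂ (graph-injective {L = B a} {B a′} x y (trans (sym w≡) w≡′)))
                     (proj₂ (graph-injective {L = B a} {B a″} x z (trans (sym w≡) w≡″))) x≢0)

  image⇒InSpan : ∀ {a a′} (κ : Kernel a a′) z → b z (Kernel.vector κ) ≡ false → InSpan (0v ++ z)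
  image⇒InSpan {a} {a′} κ z z⊥ with Kernel.image κ z z⊥
  ... | u , eq = subst InSpan graphs-sum (InSpan-⊕ (member⇒InSpan a (u , refl)) (member⇒InSpan a′ (u , refl)))
    where
    graphs-sum : graph (B a) u ⊕ graph (B a′) u ≡ 0v ++ z
    graphs-sum = trans (zipWith-++ _xor_ u (u · B a) u (u · B a′)) (cong₂ _++_ (⊕-self u) eq)

  -- Here n ≥ 2 is needed: the images k₁⊥ and k₂⊥ of B 0 + B u₁ and B 0 + B u₂ together span U.
  module _ {u₁ u₂ : Vect n} (u₁≢0 : u₁ ≢ 0v) (u₂≢0 : u₂ ≢ 0v) (u₁≢u₂ : u₁ ≢ u₂) where

    private
      κ₁ = kernel {0v} {u₁} (λ eq → u₁≢0 (sym eq))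
      κ₂ = kernel {0v} {u₂} (λ eq → u₂≢0 (sym eq))
      k₁ = Kernel.vector κ₁
      k₂ = Kernel.vector κ₂

      k₁≢k₂ : k₁ ≢ k₂
      k₁≢k₂ k₁≡k₂ = no-common-kernel (λ eq → u₁≢0 (sym eq)) (λ eq → u₂≢0 (sym eq)) u₁≢u₂ k₁
        (Kernel.coincides κ₁) (subst (Coincide 0v u₂) (sym k₁≡k₂) (Kernel.coincides κ₂)) (Kernel.nonzero κ₁)

    vertical-InSpan : ∀ z → InSpan (0v ++ z)
    vertical-InSpan z = by-value (b z k₁) refl (separating-vector k₁ k₂ (Kernel.nonzero κ₁) k₁≢k₂)
      where
      by-value : ∀ s → b z k₁ ≡ s → (∃ λ t → b t k₁ ≡ true × b t k₂ ≡ false) → InSpan (0v ++ z)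
      by-value false z⊥k₁ _ =
        subst InSpan (trans (zipWith-++ _xor_ 0v z 0v 0v) (cong₂ _++_ (⊕-identityˡ 0v) (⊕-identityʳ z)))
          (InSpan-⊕ (image⇒InSpan κ₁ z z⊥k₁) (image⇒InSpan κ₂ 0v (Left.φ-0v k₂)))
      by-value true z·k₁ (t , t·k₁ , t⊥k₂) =
        subst InSpan (trans (zipWith-++ _xor_ 0v (z ⊕ t) 0v t) (cong₂ _++_ (⊕-identityˡ 0v) z+t+t))
          (InSpan-⊕ (image⇒InSpan κ₁ (z ⊕ t) (trans (additiveˡ z t k₁) (cong₂ _xor_ z·k₁ t·k₁)))
                    (image⇒InSpan κ₂ t t⊥k₂))
        where
        z+t+t : (z ⊕ t) ⊕ t ≡ z
        z+t+t = trans (⊕-assoc z t t) (trans (cong (z ⊕_) (⊕-self t)) (⊕-identityʳ z))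

    spanning : ∀ w → InSpan w
    spanning w with VL-splits (B 0v)
    ... | decompose , _ with decompose w
    ...   | x , y , Xx , (z , refl) , refl = InSpan-⊕ (member⇒InSpan 0v Xx) (vertical-InSpan z)

    distinct-members : ∀ a a′ → a ≢ a′ → ¬ SameSub (X a) (X a′)
    distinct-members a a′ a≢a′ same = u₁≢u₂ (trans (is-kernel-vector u₁≢0) (sym (is-kernel-vector u₂≢0)))
      where
      open Kernel (kernel a≢a′)
      is-kernel-vector : ∀ {u} → u ≢ 0v → u ≡ vector
      is-kernel-vector {u} u≢0 with proj₁ (same (graph (B a) u)) (u , refl)
      ... | y , eq with unique u (proj₂ (graph-injective {L = B a} {B a′} u y eq))
      ...   | inj₁ u≡0 = ⊥-elim (u≢0 u≡0)
      ...   | inj₂ u≡k = u≡k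

    dualHyperoval : DualHyperoval n (n + n) X
    dualHyperoval = record
      { distinctMembers = distinct-members
      ; rank            = λ a → VL-rank (B a)
      ; spanning        = spanning
      ; meet2           = meet2
      ; meet3           = meet3
      }

  orthogonal : Orthogonal (Qb b) X
  orthogonal a = VL-orthogonal {b = b} {L = B a} (proj₂ (skew a))

  splits : SplitsOver (zeroPlusU n) X
  splits a = VL-splits (B a)

theorem3p12 : (n : ℕ) → 3 ≤ n → n % 2 ≡ 1 →
    (b : Vect n → Vect n → Bool) → NondegSymBilinear n b →
    (Σs : List (Op n)) → SymplecticSpreadSet n b Σs →
    (C : Vect n → Op n) → CanonicalLabeling n b Σs C →
    (∀ a → SkewSymmetric b (C a +op E b a a))
    × DualHyperoval n (n + n) (λ a → VL n (C a +op E b a a))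
    × Orthogonal (Qb b) (λ a → VL n (C a +op E b a a))
    × SplitsOver (zeroPlusU n) (λ a → VL n (C a +op E b a a))
theorem3p12 (suc (suc _)) (s≤s (s≤s _)) n-odd b nd Σs ss C cl =
  CanonicalLabeling.skew cl , dualHyperoval {true ∷ 0v} {false ∷ true ∷ 0v} (λ ()) (λ ()) (λ ()) , orthogonal , splits
  where open DHO n-odd nd ss cl
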